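{- Let $(\rho_b,\rho_g,\iota)$ be an effect-oriented rule, $m_b\colon L_b\hookrightarrow G$ a pre-match for its base rule $\rho_b$, and $\rho_i=(L_i\supseteq K_i\subseteq R_g,\mathit{ac}_i)$ an induced rule constructed from $L_i'$ and $K_i$. Then $\rho_i$ can be matched compatibly to $m_b$ if and only if: (1) (LHS compatibility) there exists an injective morphism $e_1\colon L_i'\hookrightarrow G$ with $e_1\circ\iota_L^{i\prime}=m_b$; (2) (RHS compatibility) there exists an injective morphism $e_2\colon K_i\hookrightarrow G$ with $e_2\circ\iota_K^g=m_b\circ l_b$; and (3) (applicability) the unique morphism $m_i\colon L_i\to G$ with $m_i\circ u=e_1$ and $m_i\circ l_i=e_2$ (which exists by the pushout property since $e_2\circ\iota_K^g=e_1\circ k_1$) is injective and satisfies the dangling condition for $\rho_i$. In this case, this unique morphism $m_i$ is the match for $\rho_i$ such that $m_b$ and $m_i$ are compatible.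
   Context: All graphs are finite directed multigraphs typed over a fixed type graph; all morphisms are type-preserving graph morphisms. A rule $\rho=(L\supseteq K\subseteq R,\mathit{ac})$ consists of graphs with $K$ a subgraph of $L$ and $R$ and a nested graph condition $\mathit{ac}$ over $L$; $\mathrm{Shift}(f,\mathit{ac})$ is the standard shift of $\mathit{ac}$ along an injective morphism $f$ (a morphism $m'$ satisfies it iff $m'\circ f$ satisfies $\mathit{ac}$). A pre-match of $\rho$ in $G$ is an injective $m\colon L\hookrightarrow G$ satisfying $\mathit{ac}$; it is a match if it satisfies the dangling condition (every node $v$ of $L$ with $m(v)$ incident to an edge of $G$ outside $m(L)$ lies in $K$). A subrule $\rho'$ of $\rho$ is given by injective $\iota_L,\iota_K,\iota_R$ commuting with the rule inclusions, both squares pullbacks, $\mathit{ac}\equiv\mathrm{Shift}(\iota_L,\mathit{ac}')$. Effect-oriented rule $(\rho_b,\rho_g,\iota)$: a rule $\rho_g=(L_g\supseteq K_g\subseteq R_g,\mathit{ac}_g)$ with a subrule $\rho_b=(L_b\supseteq K_b\subseteq R_b,\mathit{ac}_b)$ (inclusion $l_b\colon K_b\subseteq L_b$) via inclusions $\iota=(\iota_L,\mathrm{id},\iota_R)$, with $K_b=K_g$. Induced rule: choose graphs $L_i'$ with $L_b\subseteq L_i'\subseteq L_g$ (inclusion $\iota_L^{i\prime}\colon L_b\subseteq L_i'$) and $K_i$ with $K_g\subseteq K_i\subseteq R_g$ (inclusion $\iota_K^g\colon K_g\subseteq K_i$) and $K_i\cap R_b=K_b$; with $k_1=\iota_L^{i\prime}\circ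 l_b\colon K_b\hookrightarrow L_i'$, let $(L_i,u,l_i)$ be the pushout of $k_1$ and $\iota_K^g$, with $u\colon L_i'\subseteq L_i$ and $l_i\colon K_i\subseteq L_i$ inclusions; $\iota_L^i=u\circ\iota_L^{i\prime}$, $\mathit{ac}_i=\mathrm{Shift}(\iota_L^i,\mathit{ac}_b)$, and $\rho_i=(L_i\supseteq K_i\subseteq R_g,\mathit{ac}_i)$. A match $m_i$ of $\rho_i$ is compatible with $m_b$ if $m_i\circ\iota_L^i=m_b$; $\rho_i$ can be matched compatibly to $m_b$ if it has such a match. -}

module Defs where

open import Data.Nat using (ℕ)
open import Data.Fin using (Fin)
open import Data.Product using (Σ; Σ-syntax; ∃; ∃-syntax; _×_; _,_)
open import Data.Sum using (_⊎_)
open import Data.Unit using (⊤)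
open import Relation.Nullary using (¬_)
open import Relation.Binary.PropositionalEquality using (_≡_; refl; trans; cong; sym)
open import Function.Bundles using (_⇔_)

record TypeGraph : Set where
  field
    V E : ℕ
    src tgt : Fin E → Fin V

module Typed (T : TypeGraph) where
  private module T = TypeGraph T

  record Graph : Set where
    field
      V E   : ℕ
      src tgt : Fin E → Fin V
      tyV   : Fin V → Fin T.V
      tyE   : Fin E → Fin T.E
      tySrc : ∀ e → tyV (src e) ≡ T.src (tyE e)
      tyTgt : ∀ e → tyV (tgt e) ≡ T.tgt (tyE e)
  open Graph public

  record Mor (G H : Graph) : Set where
    field
      fV : Fin (V G) → Fin (V H)
      fE : Fin (E G) → Fin (E H)
      pSrc : ∀ e → fV (src G e) ≡ src H (fE e)
      pTgt : ∀ e → fV (tgt G e) ≡ tgt H (fE e)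
      pTyV : ∀ v → tyV H (fV v) ≡ tyV G v
      pTyE : ∀ e → tyE H (fE e) ≡ tyE G e
  open Mor public

  idM : ∀ {G} → Mor G G
  idM = record { fV = λ v → v ; fE = λ e → e
               ; pSrc = λ _ → refl ; pTgt = λ _ → refl
               ; pTyV = λ _ → refl ; pTyE = λ _ → refl }

  infixr 9 _∘M_
  _∘M_ : ∀ {A B C} → Mor B C → Mor A B → Mor A C
  g ∘M f = record
    { fV = λ v → fV g (fV f v)
    ; fE = λ e → fE g (fE f e)
    ; pSrc = λ e → trans (cong (fV g) (pSrc f e)) (pSrc g (fE f e))
    ; pTgt = λ e → trans (cong (fV g) (pTgt f e)) (pTgt g (fE f e))
    ; pTyV = λ v → trans (pTyV g (fV f v)) (pTyV f v)
    ; pTyE = λ e → trans (pTyE g (fE f e)) (pTyE f e) }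

  infix 4 _≈M_
  _≈M_ : ∀ {A B} → Mor A B → Mor A B → Set
  f ≈M g = (∀ v → fV f v ≡ fV g v) × (∀ e → fE f e ≡ fE g e)

  Injective : ∀ {A B} → Mor A B → Set
  Injective f = (∀ x y → fV f x ≡ fV f y → x ≡ y) × (∀ x y → fE f x ≡ fE f y → x ≡ y)

  IsPullback : ∀ {A B C D} → Mor A B → Mor A C → Mor B D → Mor C D → Set
  IsPullback {A} {B} {C} {D} a b c d =
    (c ∘M a ≈M d ∘M b) ×
    (∀ (X : Graph) (x : Mor X B) (y : Mor X C) → c ∘M x ≈M d ∘M y →
       Σ[ h ∈ Mor X A ] ((a ∘M h ≈M x) × (b ∘M h ≈M y) ×
         (∀ h' → a ∘M h' ≈M x → b ∘M h' ≈M y → h' ≈M h)))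

  IsPushout : ∀ {A B C D} → Mor A B → Mor A C → Mor B D → Mor C D → Set
  IsPushout {A} {B} {C} {D} f g p q =
    (p ∘M f ≈M q ∘M g) ×
    (∀ (X : Graph) (x : Mor B X) (y : Mor C X) → x ∘M f ≈M y ∘M g →
       Σ[ h ∈ Mor D X ] ((h ∘M p ≈M x) × (h ∘M q ≈M y) ×
         (∀ h' → h' ∘M p ≈M x → h' ∘M q ≈M y → h' ≈M h)))

  data Cond (P : Graph) : Set where
    tt   : Cond P
    neg  : Cond P → Cond P
    and  : Cond P → Cond P → Cond P
    exist : (C : Graph) → Mor P C → Cond C → Cond P

  Sat : ∀ {P G} → Mor P G → Cond P → Set
  Sat m tt = ⊤
  Sat m (neg c) = ¬ Sat m c
  Sat m (and c d) = Sat m c × Sat m d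
  Sat {G = G} m (exist C a c) =
    Σ[ q ∈ Mor C G ] (Injective q × (q ∘M a ≈M m) × Sat q c)

  -- 'c' is (equivalent to) Shift(f, c') : a morphism m satisfies c iff m ∘ f satisfies c'.
  IsShift : ∀ {P Q} → Mor P Q → Cond P → Cond Q → Set
  IsShift {P} {Q} f c' c = ∀ (H : Graph) (m : Mor Q H) → Sat m c ⇔ Sat (m ∘M f) c'

  Dangling : ∀ {K L G} → Mor K L → Mor L G → Set
  Dangling {K} {L} {G} l m =
    ∀ (v : Fin (V L)) (e : Fin (E G)) →
      (src G e ≡ fV m v ⊎ tgt G e ≡ fV m v) →
      ¬ (Σ[ e' ∈ Fin (E L) ] fE m e' ≡ e) →
      Σ[ k ∈ Fin (V K) ] fV l k ≡ v

  PreMatch : ∀ {L G} → Cond L → Mor L G → Set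
  PreMatch ac m = Injective m × Sat m ac

  Match : ∀ {K L G} → Mor K L → Cond L → Mor L G → Set
  Match l ac m = PreMatch ac m × Dangling l m

  -- Rule (L ⊇ K ⊆ R, ac), inclusions represented by injective morphisms.
  record Rule : Set where
    field
      L K R : Graph
      l : Mor K L
      r : Mor K R
      l-inj : Injective l
      r-inj : Injective r
      ac : Cond L

  -- Effect-oriented rule (ρ_b, ρ_g, ι) with K_b = K_g (= K) and ι_K = id.
  record EffectOrientedRule : Set where
    field
      Lb Rb Lg Rg K : Graph
      lb : Mor K Lb
      rb : Mor K Rb
      lg : Mor K Lg
      rg : Mor K Rg
      lb-inj : Injective lb
      rb-inj : Injective rb
      lg-inj : Injective lg
      rg-inj : Injective rg
      acb : Cond Lb
      acg : Cond Lg
      ιL : Mor Lb Lg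
      ιR : Mor Rb Rg
      ιL-inj : Injective ιL
      ιR-inj : Injective ιR
      -- ρ_b is a subrule of ρ_g via (ιL, id, ιR): both squares are pullbacks
      -- (this includes commutativity), and ac_g ≡ Shift(ιL, ac_b).
      left-pb  : IsPullback lb idM ιL lg
      right-pb : IsPullback rb idM ιR rg
      ac-shift : IsShift ιL acb acg

  record InducedRule (ρ : EffectOrientedRule) : Set where
    open EffectOrientedRule ρ
    field
      Li' Ki Li : Graph
      ιLi' : Mor Lb Li'
      jL   : Mor Li' Lg
      ιLi'-inj : Injective ιLi'
      jL-inj   : Injective jL
      jL-comm  : jL ∘M ιLi' ≈M ιL
      ιKg  : Mor K Ki
      ri   : Mor Ki Rg
      ιKg-inj : Injective ιKg
      ri-inj  : Injective ri
      ri-comm : ri ∘M ιKg ≈M rg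
      -- K_i ∩ R_b = K_b (inside R_g)
      cap : IsPullback ιKg rb ri ιR
      u  : Mor Li' Li
      li : Mor Ki Li
      pushout : IsPushout (ιLi' ∘M lb) ιKg u li
      aci : Cond Li
      aci-shift : IsShift (u ∘M ιLi') acb aci

    k1 : Mor K Li'
    k1 = ιLi' ∘M lb

    ιLi : Mor Lb Li
    ιLi = u ∘M ιLi'

-- A compatible match m_i yields e1 = m_i ∘ u and e2 = m_i ∘ l_i; since u and l_i are
-- jointly epic, m_i is the only mediator of the pushout for e1, e2, which gives (3).
-- Conversely, the mediator of e1, e2 is compatible with m_b because ι_L^i factors
-- through u, and hence satisfies ac_i = Shift(ι_L^i, ac_b) since m_b satisfies ac_b.
-- The one non-formal ingredient is the injectivity of e1 and e2, i.e. of the pushout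
-- legs u and l_i: in typed graphs, pushouts preserve injectivity. If p x = p y for a
-- pushout leg p : B → D opposite an injective g : A → C, colour x alone in B, extend
-- the colouring to C along g and glue both into a colouring of D by the pushout
-- property; then y has the colour of x, so y = x.
module Submission where

open import Defs
open import Data.Bool using (Bool; true; false)
open import Data.Bool.Properties using (T-≡)
open import Data.Fin using (Fin; _↑ˡ_; _↑ʳ_; splitAt; _≟_)
open import Data.Fin.Properties using (splitAt-↑ˡ; splitAt-↑ʳ; any?)
open import Data.Nat using (_+_)
open import Data.Product using (Σ-syntax; _×_; _,_; proj₁; proj₂)
open import Data.Sum using ([_,_]; map)
open import Function.Base using (_∘_)
open import Function.Bundles using (_⇔_; mk⇔; Equivalence)
open import Relation.Nullary using (yes; no; contradiction)
open import Relation.Nullary.Decidable using (⌊_⌋; toWitness; fromWitness)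
open import Relation.Binary.PropositionalEquality
  using (_≡_; refl; sym; trans; cong; cong₂; module ≡-Reasoning)

tag : ∀ {n} → Bool → Fin n → Fin (n + n)
tag {n} false i = i ↑ˡ n
tag {n} true  i = n ↑ʳ i

untag : ∀ n → Fin (n + n) → Bool × Fin n
untag n w = [ (λ i → false , i) , (λ i → true , i) ] (splitAt n w)

untag-tag : ∀ {n} b (i : Fin n) → untag n (tag b i) ≡ (b , i)
untag-tag {n} false i rewrite splitAt-↑ˡ n i n = refl
untag-tag {n} true  i rewrite splitAt-↑ʳ n n i = refl

indicator : ∀ {n} → Fin n → Fin n → Bool
indicator x v = ⌊ v ≟ x ⌋

indicator-self : ∀ {n} (x : Fin n) → indicator x x ≡ true
indicator-self x = Equivalence.to T-≡ (fromWitness {a? = x ≟ x} refl)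

indicator-true⇒≡ : ∀ {n} (x v : Fin n) → indicator x v ≡ true → v ≡ x
indicator-true⇒≡ x v eq = toWitness {a? = v ≟ x} (Equivalence.from T-≡ eq)

colourings-factor⇒injective : ∀ {m n} (p : Fin m → Fin n) →
  (∀ (c : Fin m → Bool) → Σ[ c' ∈ (Fin n → Bool) ] (∀ x → c' (p x) ≡ c x)) →
  ∀ x y → p x ≡ p y → x ≡ y
colourings-factor⇒injective p factor x y px≡py with factor (indicator x)
... | c' , c'∘p≡c = sym (indicator-true⇒≡ x y (begin
  indicator x y ≡⟨ c'∘p≡c y ⟨
  c' (p y)      ≡⟨ cong c' px≡py ⟨
  c' (p x)      ≡⟨ c'∘p≡c x ⟩
  indicator x x ≡⟨ indicator-self x ⟩
  true          ∎))
  where open ≡-Reasoning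

extendAlong : ∀ {m n} → (Fin m → Fin n) → (Fin m → Bool) → Fin n → Bool
extendAlong g c w with any? (λ a → g a ≟ w)
... | yes (a , _) = c a
... | no _        = false

extendAlong-∘ : ∀ {m n} (g : Fin m → Fin n) (c : Fin m → Bool) →
                (∀ a b → g a ≡ g b → a ≡ b) → ∀ a → extendAlong g c (g a) ≡ c a
extendAlong-∘ g c g-inj a with any? (λ a' → g a' ≟ g a)
... | yes (a' , eq) = cong c (g-inj a' a eq)
... | no  ∄a        = contradiction (a , refl) ∄a

module Properties (T : TypeGraph) where
  open Typed T
  private module T = TypeGraph T

  ≈M-refl : ∀ {A B} {f : Mor A B} → f ≈M f
  ≈M-refl = (λ _ → refl) , (λ _ → refl)

  ≈M-sym : ∀ {A B} {f g : Mor A B} → f ≈M g → g ≈M f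
  ≈M-sym (pV , pE) = (λ v → sym (pV v)) , (λ e → sym (pE e))

  ≈M-trans : ∀ {A B} {f g h : Mor A B} → f ≈M g → g ≈M h → f ≈M h
  ≈M-trans (pV , pE) (qV , qE) = (λ v → trans (pV v) (qV v)) , (λ e → trans (pE e) (qE e))

  ∘M-congˡ : ∀ {A B C} (h : Mor B C) {f g : Mor A B} → f ≈M g → h ∘M f ≈M h ∘M g
  ∘M-congˡ h (pV , pE) = (λ v → cong (fV h) (pV v)) , (λ e → cong (fE h) (pE e))

  ∘M-congʳ : ∀ {A B C} {f g : Mor B C} → f ≈M g → (h : Mor A B) → f ∘M h ≈M g ∘M h
  ∘M-congʳ (pV , pE) h = (λ v → pV (fV h v)) , (λ e → pE (fE h e))

  Injective-∘ : ∀ {A B C} {g : Mor B C} {f : Mor A B} →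
                Injective g → Injective f → Injective (g ∘M f)
  Injective-∘ (gV , gE) (fV' , fE') =
    (λ x y eq → fV' x y (gV _ _ eq)) , (λ x y eq → fE' x y (gE _ _ eq))

  Injective-resp-≈ : ∀ {A B} {m m' : Mor A B} → m ≈M m' → Injective m → Injective m'
  Injective-resp-≈ (pV , pE) (iV , iE) =
    (λ x y eq → iV x y (trans (pV x) (trans eq (sym (pV y))))) ,
    (λ x y eq → iE x y (trans (pE x) (trans eq (sym (pE y)))))

  Dangling-resp-≈ : ∀ {K L G} {l : Mor K L} {m m' : Mor L G} →
                    m ≈M m' → Dangling l m → Dangling l m'
  Dangling-resp-≈ (pV , pE) d v e incident ∄preimage =
    d v e (map (λ s → trans s (sym (pV v))) (λ t → trans t (sym (pV v))) incident)
      (λ (e' , eq) → ∄preimage (e' , trans (sym (pE e')) eq))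

  Sat-resp-≈ : ∀ {P G} {m m' : Mor P G} (c : Cond P) → m ≈M m' → Sat m c → Sat m' c
  Sat-resp-≈ tt m≈m' s = s
  Sat-resp-≈ {m = m} {m'} (neg c) m≈m' s = λ s' → s (Sat-resp-≈ c (≈M-sym {f = m} {m'} m≈m') s')
  Sat-resp-≈ (and c d) m≈m' (s , t) = Sat-resp-≈ c m≈m' s , Sat-resp-≈ d m≈m' t
  Sat-resp-≈ {m = m} {m'} (exist C a c) m≈m' (q , q-inj , qa≈m , s) =
    q , q-inj , ≈M-trans {f = q ∘M a} {m} {m'} qa≈m m≈m' , s

  IsPushout-sym : ∀ {A B C D} {f : Mor A B} {g : Mor A C} {p : Mor B D} {q : Mor C D} →
                  IsPushout f g p q → IsPushout g f q p
  IsPushout-sym {f = f} {g} {p} {q} (commutes , universal) =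
    ≈M-sym {f = p ∘M f} {q ∘M g} commutes ,
    λ X x y x∘g≈y∘f →
      let (h , h∘q≈y , h∘p≈x , unique) = universal X y x (≈M-sym {f = x ∘M g} {y ∘M f} x∘g≈y∘f)
      in h , h∘p≈x , h∘q≈y , λ h' h'∘q≈x h'∘p≈y → unique h' h'∘p≈y h'∘q≈x

  IsPushout-jointlyEpic : ∀ {A B C D X} {f : Mor A B} {g : Mor A C} {p : Mor B D} {q : Mor C D} →
                          IsPushout f g p q → (h h' : Mor D X) →
                          h ∘M p ≈M h' ∘M p → h ∘M q ≈M h' ∘M q → h ≈M h'
  IsPushout-jointlyEpic {X = X} {f} {g} {p} {q} (commutes , universal) h h' hp≈h'p hq≈h'q
    with universal X (h ∘M p) (h ∘M q) (∘M-congˡ h {p ∘M f} {q ∘M g} commutes)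
  ... | k , _ , _ , unique =
    ≈M-trans {f = h} {k} {h'}
      (unique h (≈M-refl {f = h ∘M p}) (≈M-refl {f = h ∘M q}))
      (≈M-sym {f = h'} {k} (unique h' (≈M-sym {f = h ∘M p} {h' ∘M p} hp≈h'p)
                                       (≈M-sym {f = h ∘M q} {h' ∘M q} hq≈h'q)))

  -- Morphisms A → NodeColours amount to arbitrary Bool-colourings of the nodes of A:
  -- a node is (colour, node type), an edge (source colour, target colour, edge type).
  NodeColours : Graph
  NodeColours = record
    { V = T.V + T.V ; E = (T.E + T.E) + (T.E + T.E)
    ; src = λ w → tag (srcColour w) (T.src (edgeType w))
    ; tgt = λ w → tag (tgtColour w) (T.tgt (edgeType w))
    ; tyV = λ v → proj₂ (untag T.V v)
    ; tyE = edgeType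
    ; tySrc = λ w → cong proj₂ (untag-tag (srcColour w) (T.src (edgeType w)))
    ; tyTgt = λ w → cong proj₂ (untag-tag (tgtColour w) (T.tgt (edgeType w))) }
    where
    srcColour tgtColour : Fin ((T.E + T.E) + (T.E + T.E)) → Bool
    srcColour w = proj₁ (untag (T.E + T.E) w)
    tgtColour w = proj₁ (untag T.E (proj₂ (untag (T.E + T.E) w)))

    edgeType : Fin ((T.E + T.E) + (T.E + T.E)) → Fin T.E
    edgeType w = proj₂ (untag T.E (proj₂ (untag (T.E + T.E) w)))

  nodeColour : Fin (V NodeColours) → Bool
  nodeColour v = proj₁ (untag T.V v)

  colourNodes : (A : Graph) → (Fin (V A) → Bool) → Mor A NodeColours
  colourNodes A c = record
    { fV = λ v → tag (c v) (tyV A v)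
    ; fE = edge
    ; pSrc = λ e → trans (cong (tag (c (src A e))) (tySrc A e)) (sym (cong₂ tag (srcColour e) (srcType e)))
    ; pTgt = λ e → trans (cong (tag (c (tgt A e))) (tyTgt A e)) (sym (cong₂ tag (tgtColour e) (tgtType e)))
    ; pTyV = λ v → cong proj₂ (untag-tag (c v) (tyV A v))
    ; pTyE = edgeType }
    where
    edge : Fin (E A) → Fin (E NodeColours)
    edge e = tag (c (src A e)) (tag (c (tgt A e)) (tyE A e))

    decode : ∀ e → untag (T.E + T.E) (edge e) ≡ (c (src A e) , tag (c (tgt A e)) (tyE A e))
    decode e = untag-tag (c (src A e)) (tag (c (tgt A e)) (tyE A e))

    edgeType : ∀ e → tyE NodeColours (edge e) ≡ tyE A e
    edgeType e rewrite decode e = cong proj₂ (untag-tag (c (tgt A e)) (tyE A e))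

    srcColour : ∀ e → proj₁ (untag (T.E + T.E) (edge e)) ≡ c (src A e)
    srcColour e = cong proj₁ (decode e)

    tgtColour : ∀ e → proj₁ (untag T.E (proj₂ (untag (T.E + T.E) (edge e)))) ≡ c (tgt A e)
    tgtColour e rewrite decode e = cong proj₁ (untag-tag (c (tgt A e)) (tyE A e))

    srcType : ∀ e → T.src (tyE NodeColours (edge e)) ≡ T.src (tyE A e)
    srcType e = cong T.src (edgeType e)

    tgtType : ∀ e → T.tgt (tyE NodeColours (edge e)) ≡ T.tgt (tyE A e)
    tgtType e = cong T.tgt (edgeType e)

  nodeColour-colourNodes : ∀ A c v → nodeColour (fV (colourNodes A c) v) ≡ c v
  nodeColour-colourNodes A c v = cong proj₁ (untag-tag (c v) (tyV A v))

  colourNodes-∘ : ∀ {A B C} (f : Mor A B) (g : Mor A C) cB cC →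
                  (∀ a → cB (fV f a) ≡ cC (fV g a)) →
                  colourNodes B cB ∘M f ≈M colourNodes C cC ∘M g
  colourNodes-∘ {A} {B} {C} f g cB cC agree =
    (λ a → cong₂ tag (agree a) (trans (pTyV f a) (sym (pTyV g a)))) ,
    (λ e → cong₂ tag (agreeSrc e) (cong₂ tag (agreeTgt e) (trans (pTyE f e) (sym (pTyE g e)))))
    where
    agreeSrc : ∀ e → cB (src B (fE f e)) ≡ cC (src C (fE g e))
    agreeSrc e = trans (cong cB (sym (pSrc f e))) (trans (agree (src A e)) (cong cC (pSrc g e)))

    agreeTgt : ∀ e → cB (tgt B (fE f e)) ≡ cC (tgt C (fE g e))
    agreeTgt e = trans (cong cB (sym (pTgt f e))) (trans (agree (tgt A e)) (cong cC (pTgt g e)))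

  -- Morphisms A → EdgeColours amount to arbitrary Bool-colourings of the edges of A.
  EdgeColours : Graph
  EdgeColours = record
    { V = T.V ; E = T.E + T.E
    ; src = λ w → T.src (proj₂ (untag T.E w))
    ; tgt = λ w → T.tgt (proj₂ (untag T.E w))
    ; tyV = λ v → v
    ; tyE = λ w → proj₂ (untag T.E w)
    ; tySrc = λ _ → refl
    ; tyTgt = λ _ → refl }

  edgeColour : Fin (E EdgeColours) → Bool
  edgeColour w = proj₁ (untag T.E w)

  colourEdges : (A : Graph) → (Fin (E A) → Bool) → Mor A EdgeColours
  colourEdges A d = record
    { fV = tyV A
    ; fE = λ e → tag (d e) (tyE A e)
    ; pSrc = λ e → trans (tySrc A e) (cong T.src (sym (edgeType e)))
    ; pTgt = λ e → trans (tyTgt A e) (cong T.tgt (sym (edgeType e)))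
    ; pTyV = λ _ → refl
    ; pTyE = edgeType }
    where
    edgeType : ∀ e → proj₂ (untag T.E (tag (d e) (tyE A e))) ≡ tyE A e
    edgeType e = cong proj₂ (untag-tag (d e) (tyE A e))

  edgeColour-colourEdges : ∀ A d e → edgeColour (fE (colourEdges A d) e) ≡ d e
  edgeColour-colourEdges A d e = cong proj₁ (untag-tag (d e) (tyE A e))

  colourEdges-∘ : ∀ {A B C} (f : Mor A B) (g : Mor A C) dB dC →
                  (∀ a → dB (fE f a) ≡ dC (fE g a)) →
                  colourEdges B dB ∘M f ≈M colourEdges C dC ∘M g
  colourEdges-∘ f g dB dC agree =
    (λ a → trans (pTyV f a) (sym (pTyV g a))) ,
    (λ e → cong₂ tag (agree e) (trans (pTyE f e) (sym (pTyE g e))))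

  colourNodes-extendAlong : ∀ {A B C} (f : Mor A B) (g : Mor A C) → Injective g → ∀ c →
    colourNodes B c ∘M f ≈M colourNodes C (extendAlong (fV g) (c ∘ fV f)) ∘M g
  colourNodes-extendAlong f g (g-injV , _) c =
    colourNodes-∘ f g c (extendAlong (fV g) (c ∘ fV f))
      (λ a → sym (extendAlong-∘ (fV g) (c ∘ fV f) g-injV a))

  colourEdges-extendAlong : ∀ {A B C} (f : Mor A B) (g : Mor A C) → Injective g → ∀ d →
    colourEdges B d ∘M f ≈M colourEdges C (extendAlong (fE g) (d ∘ fE f)) ∘M g
  colourEdges-extendAlong f g (_ , g-injE) d =
    colourEdges-∘ f g d (extendAlong (fE g) (d ∘ fE f))
      (λ a → sym (extendAlong-∘ (fE g) (d ∘ fE f) g-injE a))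

  IsPushout-factors-nodeColourings :
    ∀ {A B C D} {f : Mor A B} {g : Mor A C} {p : Mor B D} {q : Mor C D} →
    IsPushout f g p q → Injective g → ∀ (c : Fin (V B) → Bool) →
    Σ[ c' ∈ (Fin (V D) → Bool) ] (∀ x → c' (fV p x) ≡ c x)
  IsPushout-factors-nodeColourings {B = B} {C} {f = f} {g} (_ , universal) g-inj c
    with universal NodeColours (colourNodes B c) (colourNodes C (extendAlong (fV g) (c ∘ fV f)))
                   (colourNodes-extendAlong f g g-inj c)
  ... | h , hp≈c , _ =
    nodeColour ∘ fV h , λ x → trans (cong nodeColour (proj₁ hp≈c x)) (nodeColour-colourNodes B c x)

  IsPushout-factors-edgeColourings :
    ∀ {A B C D} {f : Mor A B} {g : Mor A C} {p : Mor B D} {q : Mor C D} →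
    IsPushout f g p q → Injective g → ∀ (d : Fin (E B) → Bool) →
    Σ[ d' ∈ (Fin (E D) → Bool) ] (∀ x → d' (fE p x) ≡ d x)
  IsPushout-factors-edgeColourings {B = B} {C} {f = f} {g} (_ , universal) g-inj d
    with universal EdgeColours (colourEdges B d) (colourEdges C (extendAlong (fE g) (d ∘ fE f)))
                   (colourEdges-extendAlong f g g-inj d)
  ... | h , hp≈d , _ =
    edgeColour ∘ fE h , λ x → trans (cong edgeColour (proj₂ hp≈d x)) (edgeColour-colourEdges B d x)

  IsPushout-preserves-injective :
    ∀ {A B C D} {f : Mor A B} {g : Mor A C} {p : Mor B D} {q : Mor C D} →
    IsPushout f g p q → Injective g → Injective p
  IsPushout-preserves-injective {f = f} {g} {p} {q} po g-inj =
    colourings-factor⇒injective (fV p) (IsPushout-factors-nodeColourings {f = f} {g} {p} {q} po g-inj) ,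
    colourings-factor⇒injective (fE p) (IsPushout-factors-edgeColourings {f = f} {g} {p} {q} po g-inj)

module InducedRuleMatching (T : TypeGraph) (ρ : Typed.EffectOrientedRule T)
                           (ρi : Typed.InducedRule T ρ) where
  open Typed T
  open Properties T
  open EffectOrientedRule ρ
  open InducedRule ρi

  u-injective : Injective u
  u-injective = IsPushout-preserves-injective {f = k1} {ιKg} {u} {li} pushout ιKg-inj

  li-injective : Injective li
  li-injective =
    IsPushout-preserves-injective {f = ιKg} {k1} {li} {u}
      (IsPushout-sym {f = k1} {ιKg} {u} {li} pushout)
      (Injective-∘ {g = ιLi'} {lb} ιLi'-inj lb-inj)

  module _ {G : Graph} (mb : Mor Lb G) where

    CompatibleMatch : Set
    CompatibleMatch = Σ[ mi ∈ Mor Li G ] (Match li aci mi × (mi ∘M ιLi ≈M mb))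

    LhsCompatible : Mor Li' G → Set
    LhsCompatible e1 = Injective e1 × (e1 ∘M ιLi' ≈M mb)

    RhsCompatible : Mor Ki G → Set
    RhsCompatible e2 = Injective e2 × (e2 ∘M ιKg ≈M mb ∘M lb)

    Applicable : Mor Li' G → Mor Ki G → Set
    Applicable e1 e2 = ∀ (mi : Mor Li G) → mi ∘M u ≈M e1 → mi ∘M li ≈M e2 →
                       Injective mi × Dangling li mi

    Conditions : Set
    Conditions = Σ[ e1 ∈ Mor Li' G ] Σ[ e2 ∈ Mor Ki G ]
                   (LhsCompatible e1 × RhsCompatible e2 × Applicable e1 e2)

    compatible-via-u : ∀ {e1 : Mor Li' G} (mi : Mor Li G) →
                       mi ∘M u ≈M e1 → e1 ∘M ιLi' ≈M mb → mi ∘M ιLi ≈M mb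
    compatible-via-u {e1} mi mi∘u≈e1 e1-compat =
      ≈M-trans {f = mi ∘M ιLi} {e1 ∘M ιLi'} {mb} (∘M-congʳ {f = mi ∘M u} {e1} mi∘u≈e1 ιLi') e1-compat

    compatible⇒Sat : PreMatch acb mb → (mi : Mor Li G) → mi ∘M ιLi ≈M mb → Sat mi aci
    compatible⇒Sat (_ , mb⊨acb) mi compatible =
      Equivalence.from (aci-shift G mi)
        (Sat-resp-≈ {m = mb} {mi ∘M ιLi} acb (≈M-sym {f = mi ∘M ιLi} {mb} compatible) mb⊨acb)

    mediator-isCompatibleMatch : PreMatch acb mb → ∀ {e1 e2} →
      e1 ∘M ιLi' ≈M mb → Applicable e1 e2 →
      ∀ (mi : Mor Li G) → mi ∘M u ≈M e1 → mi ∘M li ≈M e2 → Match li aci mi × (mi ∘M ιLi ≈M mb)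
    mediator-isCompatibleMatch pm {e1} e1-compat applicable mi mi∘u≈e1 mi∘li≈e2
      with applicable mi mi∘u≈e1 mi∘li≈e2
    ... | mi-inj , mi-dangling =
      ((mi-inj , compatible⇒Sat pm mi compatible) , mi-dangling) , compatible
      where
      compatible : mi ∘M ιLi ≈M mb
      compatible = compatible-via-u {e1} mi mi∘u≈e1 e1-compat

    compatibleMatch⇒conditions : CompatibleMatch → Conditions
    compatibleMatch⇒conditions (mi , ((mi-inj , _) , mi-dangling) , compatible) =
      mi ∘M u , mi ∘M li ,
      (Injective-∘ {g = mi} {u} mi-inj u-injective , compatible) ,
      (Injective-∘ {g = mi} {li} mi-inj li-injective , e2-compat) ,
      applicable
      where
      e2-compat : (mi ∘M li) ∘M ιKg ≈M mb ∘M lb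
      e2-compat =
        ≈M-trans {f = mi ∘M li ∘M ιKg} {mi ∘M u ∘M k1} {mb ∘M lb}
          (∘M-congˡ mi {li ∘M ιKg} {u ∘M k1} (≈M-sym {f = u ∘M k1} {li ∘M ιKg} (proj₁ pushout)))
          (∘M-congʳ {f = mi ∘M ιLi} {mb} compatible lb)

      applicable : Applicable (mi ∘M u) (mi ∘M li)
      applicable mi' mi'∘u≈mi∘u mi'∘li≈mi∘li =
        Injective-resp-≈ {m = mi} {mi'} mi≈mi' mi-inj ,
        Dangling-resp-≈ {l = li} {mi} {mi'} mi≈mi' mi-dangling
        where
        mi≈mi' : mi ≈M mi'
        mi≈mi' = IsPushout-jointlyEpic {f = k1} {ιKg} {u} {li} pushout mi mi'
                   (≈M-sym {f = mi' ∘M u} {mi ∘M u} mi'∘u≈mi∘u)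
                   (≈M-sym {f = mi' ∘M li} {mi ∘M li} mi'∘li≈mi∘li)

    pushout-mediator : ∀ {e1 e2} → e1 ∘M ιLi' ≈M mb → e2 ∘M ιKg ≈M mb ∘M lb →
                       Σ[ mi ∈ Mor Li G ] ((mi ∘M u ≈M e1) × (mi ∘M li ≈M e2))
    pushout-mediator {e1} {e2} e1-compat e2-compat
      with proj₂ pushout G e1 e2 e1∘k1≈e2∘ιKg
      where
      e1∘k1≈e2∘ιKg : e1 ∘M k1 ≈M e2 ∘M ιKg
      e1∘k1≈e2∘ιKg =
        ≈M-trans {f = e1 ∘M k1} {mb ∘M lb} {e2 ∘M ιKg}
          (∘M-congʳ {f = e1 ∘M ιLi'} {mb} e1-compat lb)
          (≈M-sym {f = e2 ∘M ιKg} {mb ∘M lb} e2-compat)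
    ... | mi , mi∘u≈e1 , mi∘li≈e2 , _ = mi , mi∘u≈e1 , mi∘li≈e2

    conditions⇒compatibleMatch : PreMatch acb mb → Conditions → CompatibleMatch
    conditions⇒compatibleMatch pm (e1 , e2 , (_ , e1-compat) , (_ , e2-compat) , applicable)
      with pushout-mediator {e1} {e2} e1-compat e2-compat
    ... | mi , mi∘u≈e1 , mi∘li≈e2 =
      mi , mediator-isCompatibleMatch pm {e1} {e2} e1-compat applicable mi mi∘u≈e1 mi∘li≈e2

lemma1 : (T : TypeGraph) → let open Typed T in
         (ρ : EffectOrientedRule) (ρi : InducedRule ρ) →
         let open EffectOrientedRule ρ
             open InducedRule ρi
         in (G : Graph) (mb : Mor Lb G) → PreMatch acb mb →
         ((Σ[ mi ∈ Mor Li G ] (Match li aci mi × (mi ∘M ιLi ≈M mb)))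
           ⇔
          (Σ[ e1 ∈ Mor Li' G ] Σ[ e2 ∈ Mor Ki G ]
             ((Injective e1 × (e1 ∘M ιLi' ≈M mb)) ×
              (Injective e2 × (e2 ∘M ιKg ≈M mb ∘M lb)) ×
              (∀ (mi : Mor Li G) → mi ∘M u ≈M e1 → mi ∘M li ≈M e2 →
                 Injective mi × Dangling li mi))))
         ×
         (∀ (e1 : Mor Li' G) (e2 : Mor Ki G) →
            Injective e1 → e1 ∘M ιLi' ≈M mb →
            Injective e2 → e2 ∘M ιKg ≈M mb ∘M lb →
            (∀ (mi : Mor Li G) → mi ∘M u ≈M e1 → mi ∘M li ≈M e2 →
               Injective mi × Dangling li mi) →
            ∀ (mi : Mor Li G) → mi ∘M u ≈M e1 → mi ∘M li ≈M e2 →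
               Match li aci mi × (mi ∘M ιLi ≈M mb))
lemma1 T ρ ρi G mb pm =
  mk⇔ (compatibleMatch⇒conditions mb) (conditions⇒compatibleMatch mb pm) ,
  λ e1 e2 _ e1-compat _ _ applicable →
    mediator-isCompatibleMatch mb pm {e1} {e2} e1-compat applicable
  where open InducedRuleMatching T ρ ρi
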